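{- Let $k\ge1$, let $G$ be a $k$-pseudorandom directed graph, and let $A_1,A_2,\dots,A_t$ be pairwise disjoint subsets of $V(G)$, each of size at least $2k$. Then there is a directed path $v_1v_2\cdots v_t$ in $G$ with $v_i\in A_i$ for every $1\le i\le t$.
   Context: A directed graph $G$ is $k$-pseudorandom if for every two disjoint vertex sets $A,B$ with $|A|,|B|\ge k$ there is at least one edge of $G$ directed from a vertex of $A$ to a vertex of $B$. -}

module Defs where

open import Data.Nat using (ℕ; suc; _≤_; _*_)
open import Data.Fin using (Fin; inject₁; suc)
open import Data.Fin.Subset using (Subset; _∈_; ∣_∣)
open import Data.Product using (_×_; ∃)
open import Data.Empty using (⊥)
open import Relation.Nullary using (¬_)
open import Relation.Binary.PropositionalEquality using (_≡_)
open import Level using (Level; _⊔_) renaming (suc to lsuc; zero to lzero)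

Digraph : ℕ → Set₁
Digraph n = Fin n → Fin n → Set

Disjoint : {n : ℕ} → Subset n → Subset n → Set
Disjoint A B = ∀ x → x ∈ A → x ∈ B → ⊥

Pseudorandom : {n : ℕ} → ℕ → Digraph n → Set
Pseudorandom {n} k G =
  (A B : Subset n) → Disjoint A B → k ≤ ∣ A ∣ → k ≤ ∣ B ∣ →
  ∃ λ a → ∃ λ b → a ∈ A × b ∈ B × G a b

IsDirectedPath : {n m : ℕ} → Digraph n → (Fin (suc m) → Fin n) → Set
IsDirectedPath {n} {m} G v =
  (∀ i j → v i ≡ v j → i ≡ j) ×
  (∀ (i : Fin m) → G (v (inject₁ i)) (v (suc i)))

-- Working backwards from the last layer, find in each A i a set of at least k
-- vertices from which a path through A i, A (i+1), …, A t starts.  Given such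
-- a set S ⊆ A (i+1), the vertices of A i with no out-neighbour in S number
-- fewer than k: otherwise pseudorandomness would give an edge from them into
-- S.  Since |A i| ≥ 2k, at least k vertices of A i extend a path starting in S.
module Submission where

open import Defs
open import Data.Nat using (ℕ; suc; _≤_; _*_)
open import Data.Fin using (Fin)
open import Data.Fin.Subset using (Subset; _∈_; ∣_∣)
open import Data.Product using (_×_; Σ)
open import Relation.Nullary using (¬_)
open import Relation.Binary.PropositionalEquality using (_≡_)

open import Data.Nat using (zero; _+_; _<_; z≤n; s≤s; _≤?_)
open import Data.Nat.Properties
  using (≤-trans; ≤-reflexive; n≤1+n; +-suc; +-monoʳ-≤; +-identityʳ;
         +-cancelʳ-≤; m≤m+n; <⇒≤; ≰⇒>; module ≤-Reasoning)
open import Data.Nat.Induction using (<-wellFounded)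
open import Data.Fin using (zero; suc; inject₁; _≟_)
open import Data.Fin.Properties using (suc-injective)
open import Data.Fin.Subset using (_⊆_; _∉_; _─_; _-_; ⁅_⁆; ⊥; inside; outside; Nonempty)
open import Data.Fin.Subset.Properties
  using (p─q⊆p; x∈p∧x≢y⇒x∈p-y; x∈p⇒∣p-x∣<∣p∣; nonempty?; Empty-unique; ∣⊥∣≡0)
open import Data.Vec using (_∷_; []; here; there)
open import Data.Product using (_,_; ∃)
open import Function using (_∘_)
open import Induction.WellFounded using (Acc; acc)
open import Relation.Nullary using (yes; no; contradiction)
open import Relation.Binary.PropositionalEquality using (refl; sym; cong; subst)

x∈p─q⇒x∉q : ∀ {n} {x : Fin n} (p q : Subset n) → x ∈ p ─ q → x ∉ q
x∈p─q⇒x∉q (inside ∷ p) (outside ∷ q) here ()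
x∈p─q⇒x∉q (_ ∷ p) (_ ∷ q) (there x∈p─q) (there x∈q) = x∈p─q⇒x∉q p q x∈p─q x∈q

∣p∣≤∣p─q∣+∣q∣ : ∀ {n} (p q : Subset n) → ∣ p ∣ ≤ ∣ p ─ q ∣ + ∣ q ∣
∣p∣≤∣p─q∣+∣q∣ [] [] = z≤n
∣p∣≤∣p─q∣+∣q∣ (outside ∷ p) (outside ∷ q) = ∣p∣≤∣p─q∣+∣q∣ p q
∣p∣≤∣p─q∣+∣q∣ (outside ∷ p) (inside ∷ q) =
  ≤-trans (∣p∣≤∣p─q∣+∣q∣ p q) (+-monoʳ-≤ ∣ p ─ q ∣ (n≤1+n ∣ q ∣))
∣p∣≤∣p─q∣+∣q∣ (inside ∷ p) (outside ∷ q) = s≤s (∣p∣≤∣p─q∣+∣q∣ p q)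
∣p∣≤∣p─q∣+∣q∣ (inside ∷ p) (inside ∷ q) =
  ≤-trans (s≤s (∣p∣≤∣p─q∣+∣q∣ p q)) (≤-reflexive (sym (+-suc _ _)))

∣p∣>0⇒Nonempty : ∀ {n} (p : Subset n) → 1 ≤ ∣ p ∣ → Nonempty p
∣p∣>0⇒Nonempty {n} p 1≤∣p∣ with nonempty? p
... | yes ne = ne
... | no empty = contradiction 1≤0 λ ()
  where
  open ≤-Reasoning
  1≤0 : 1 ≤ 0
  1≤0 = begin
    1         ≤⟨ 1≤∣p∣ ⟩
    ∣ p ∣     ≡⟨ cong ∣_∣ (Empty-unique empty) ⟩
    ∣ ⊥ {n} ∣ ≡⟨ ∣⊥∣≡0 n ⟩
    0         ∎

PairwiseDisjoint : ∀ {n m} → (Fin m → Subset n) → Set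
PairwiseDisjoint A = ∀ i j → ¬ i ≡ j → Disjoint (A i) (A j)

OutNeighbourIn : ∀ {n} → Digraph n → Subset n → Fin n → Set
OutNeighbourIn G S x = ∃ λ y → y ∈ S × G x y

record WalkThrough {n t} (G : Digraph n) (A : Fin (suc t) → Subset n) : Set where
  field
    vertex  : Fin (suc t) → Fin n
    vertex∈ : ∀ i → vertex i ∈ A i
    edge    : ∀ (i : Fin t) → G (vertex (inject₁ i)) (vertex (suc i))

open WalkThrough

WalkFrom : ∀ {n t} → Digraph n → (Fin (suc t) → Subset n) → Fin n → Set
WalkFrom G A x = Σ (WalkThrough G A) λ w → vertex w zero ≡ x

WalkFrom⇒∈ : ∀ {n t} {G : Digraph n} {A : Fin (suc t) → Subset n} {x} →
             WalkFrom G A x → x ∈ A zero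
WalkFrom⇒∈ (w , refl) = vertex∈ w zero

walk-cons : ∀ {n t} {G : Digraph n} {A : Fin (suc (suc t)) → Subset n} {x y} →
            x ∈ A zero → G x y → WalkFrom G (A ∘ suc) y → WalkFrom G A x
walk-cons {x = x} x∈A₀ xy (w , refl) = record
  { vertex  = λ { zero → x ; (suc i) → vertex w i }
  ; vertex∈ = λ { zero → x∈A₀ ; (suc i) → vertex∈ w i }
  ; edge    = λ { zero → xy ; (suc i) → edge w i }
  } , refl

walk-injective : ∀ {n t} {G : Digraph n} {A : Fin (suc t) → Subset n} →
                 PairwiseDisjoint A → (w : WalkThrough G A) →
                 ∀ i j → vertex w i ≡ vertex w j → i ≡ j
walk-injective {A = A} disjoint w i j wi≡wj with i ≟ j
... | yes i≡j = i≡j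
... | no i≢j  = contradiction (subst (_∈ A j) (sym wi≡wj) (vertex∈ w j))
                              (disjoint i j i≢j (vertex w i) (vertex∈ w i))

module _ {n k} {G : Digraph n} (pseudorandom : Pseudorandom k G) where

  few-without-out-neighbour : ∀ {X S : Subset n} → Disjoint X S → k ≤ ∣ S ∣ →
    ∃ λ U → ∣ U ∣ < k × (∀ x → x ∈ X → x ∉ U → OutNeighbourIn G S x)
  few-without-out-neighbour {X} {S} X#S k≤∣S∣ =
    shrink X (λ x∈X → x∈X) (λ _ x∈X x∉X → contradiction x∈X x∉X) (<-wellFounded ∣ X ∣)
    where
    -- G is not decidable, so the vertices of X without an out-neighbour in S
    -- are only over-approximated by U; each round removes from U a vertex that
    -- pseudorandomness shows to have one.
    shrink : ∀ U → U ⊆ X → (∀ x → x ∈ X → x ∉ U → OutNeighbourIn G S x) → Acc _<_ ∣ U ∣ →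
             ∃ λ U → ∣ U ∣ < k × (∀ x → x ∈ X → x ∉ U → OutNeighbourIn G S x)
    shrink U U⊆X outside-U (acc smaller) with k ≤? ∣ U ∣
    ... | no k≰∣U∣ = U , ≰⇒> k≰∣U∣ , outside-U
    ... | yes k≤∣U∣ with pseudorandom U S (λ x → X#S x ∘ U⊆X) k≤∣U∣ k≤∣S∣
    ...   | a , b , a∈U , b∈S , ab =
      shrink (U - a) (U⊆X ∘ p─q⊆p U ⁅ a ⁆) outside-U-a (smaller (x∈p⇒∣p-x∣<∣p∣ a∈U))
      where
      outside-U-a : ∀ x → x ∈ X → x ∉ U - a → OutNeighbourIn G S x
      outside-U-a x x∈X x∉U-a with x ≟ a
      ... | yes refl = b , b∈S , ab
      ... | no x≢a   = outside-U x x∈X (λ x∈U → x∉U-a (x∈p∧x≢y⇒x∈p-y x∈U x≢a))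

  many-with-out-neighbour : ∀ {X S : Subset n} → Disjoint X S → k ≤ ∣ S ∣ → 2 * k ≤ ∣ X ∣ →
    ∃ λ R → k ≤ ∣ R ∣ × (∀ x → x ∈ R → x ∈ X × OutNeighbourIn G S x)
  many-with-out-neighbour {X} {S} X#S k≤∣S∣ 2k≤∣X∣
    with few-without-out-neighbour X#S k≤∣S∣
  ... | U , ∣U∣<k , outside-U =
    X ─ U , k≤∣X─U∣ ,
    λ x x∈X─U → let x∈X = p─q⊆p X U x∈X─U in x∈X , outside-U x x∈X (x∈p─q⇒x∉q X U x∈X─U)
    where
    open ≤-Reasoning
    k≤∣X─U∣ : k ≤ ∣ X ─ U ∣
    k≤∣X─U∣ = +-cancelʳ-≤ k k ∣ X ─ U ∣ (begin
      k + k             ≡⟨ cong (k +_) (sym (+-identityʳ k)) ⟩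
      2 * k             ≤⟨ 2k≤∣X∣ ⟩
      ∣ X ∣             ≤⟨ ∣p∣≤∣p─q∣+∣q∣ X U ⟩
      ∣ X ─ U ∣ + ∣ U ∣ ≤⟨ +-monoʳ-≤ ∣ X ─ U ∣ (<⇒≤ ∣U∣<k) ⟩
      ∣ X ─ U ∣ + k     ∎)

  many-walk-starts : ∀ t (A : Fin (suc t) → Subset n) → PairwiseDisjoint A →
    (∀ i → 2 * k ≤ ∣ A i ∣) → ∃ λ R → k ≤ ∣ R ∣ × (∀ x → x ∈ R → WalkFrom G A x)
  many-walk-starts zero A _ large =
    A zero , ≤-trans (m≤m+n k (k + 0)) (large zero) ,
    λ x x∈A₀ → record { vertex = λ _ → x ; vertex∈ = λ { zero → x∈A₀ } ; edge = λ () } , refl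
  many-walk-starts (suc t) A disjoint large
    with many-walk-starts t (A ∘ suc) (λ i j i≢j → disjoint (suc i) (suc j) (i≢j ∘ suc-injective))
                                      (large ∘ suc)
  ... | S , k≤∣S∣ , walk-from-S
    with many-with-out-neighbour {A zero} {S}
           (λ x x∈A₀ x∈S → disjoint zero (suc zero) (λ ()) x x∈A₀ (WalkFrom⇒∈ (walk-from-S x x∈S)))
           k≤∣S∣ (large zero)
  ... | R , k≤∣R∣ , extendable =
    R , k≤∣R∣ , λ x x∈R → let x∈A₀ , y , y∈S , xy = extendable x x∈R in
                          walk-cons x∈A₀ xy (walk-from-S y y∈S)

claim4p3 : (n k t : ℕ) → 1 ≤ k → (G : Digraph n) → Pseudorandom k G →
    (A : Fin (suc t) → Subset n) →
    (∀ i j → ¬ i ≡ j → Disjoint (A i) (A j)) →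
    (∀ i → 2 * k ≤ ∣ A i ∣) →
    Σ (Fin (suc t) → Fin n) (λ v → IsDirectedPath G v × (∀ i → v i ∈ A i))
claim4p3 n k t 1≤k G pseudorandom A disjoint large
  with many-walk-starts pseudorandom t A disjoint large
... | R , k≤∣R∣ , walk-from-R
  with ∣p∣>0⇒Nonempty R (≤-trans 1≤k k≤∣R∣)
... | x , x∈R =
  let w , _ = walk-from-R x x∈R in
  vertex w , (walk-injective disjoint w , edge w) , vertex∈ w
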